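{- Let $n \geq 2$ be an integer and suppose $X_n$ contains an induced cycle of length $k$. If $q > 2$ is a prime not dividing $n$, then $X_{qn}$ also contains an induced cycle of length $k$. If $k$ is even, the same holds also for $q = 2$ (provided $2 \nmid n$). Consequently, $m(r+1) \geq m(r)$ for all $r \geq 1$, i.e. $m(r)$ is nondecreasing in $r$.
   Context: For a positive integer $n$, the unitary Cayley graph $X_n = \mathrm{Cay}(\mathbb{Z}_n, U_n)$ has vertex set $\mathbb{Z}_n$, and $x,y$ are adjacent iff $x - y \in U_n$, the group of units of $\mathbb{Z}_n$. An induced cycle of length $k \geq 3$ is a sequence of $k$ distinct vertices $v_0, \dots, v_{k-1}$ such that $v_i$ and $v_j$ are adjacent if and only if $i - j \equiv \pm 1 \pmod k$. $M(n)$ denotes the length of the longest induced cycle in $X_n$, and $m(r) = \max_n M(n)$, the maximum taken over all $n$ with exactly $r$ distinct prime divisors. -}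

module Defs where

open import Data.Nat using (ℕ; zero; suc; _+_; _*_; _∸_; _<_; _%_)
open import Data.Nat.Coprimality using (Coprime)
open import Data.Nat.Divisibility using (_∣_; _∣?_)
open import Data.Nat.Primality using (Prime; prime?)
open import Data.Fin using (Fin; toℕ)
open import Data.List using (List; length; filter; upTo)
open import Data.Product using (_×_)
open import Data.Sum using (_⊎_)
open import Function.Definitions using (Injective)
open import Relation.Binary.PropositionalEquality using (_≡_)
open import Relation.Nullary.Decidable using (_×-dec_)

-- Subtraction in ℤ_n, with elements of ℤ_n represented by 0,…,n-1.
-- (n = 0 is never used; we return 0 there.)
subMod : ℕ → ℕ → ℕ → ℕ
subMod zero    x y = 0
subMod (suc m) x y = (x + (suc m ∸ y)) % suc m

Unit : ℕ → ℕ → Set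
Unit n u = (u < n) × Coprime u n

-- Adjacency in the unitary Cayley graph X_n = Cay(ℤ_n, U_n)
Adj : ℕ → ℕ → ℕ → Set
Adj n x y = Unit n (subMod n x y)

succMod : ℕ → ℕ → ℕ
succMod zero    i = i
succMod (suc m) i = suc i % suc m

record InducedCycle (n k : ℕ) : Set where
  field
    three≤k   : 3 Data.Nat.≤ k
    v         : Fin k → ℕ
    v<n       : ∀ i → v i < n
    distinct  : Injective _≡_ _≡_ v
    adj→nbr   : ∀ i j → Adj n (v i) (v j) →
                  (toℕ j ≡ succMod k (toℕ i)) ⊎ (toℕ i ≡ succMod k (toℕ j))
    nbr→adj   : ∀ i j → (toℕ j ≡ succMod k (toℕ i)) ⊎ (toℕ i ≡ succMod k (toℕ j)) →
                  Adj n (v i) (v j)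

ω : ℕ → ℕ
ω n = length (filter (λ p → prime? p ×-dec (p ∣? n)) (upTo (suc n)))

-- A residue modulo qn is a unit iff it is a unit modulo n and modulo q, so for coprime q and n
-- the Chinese remainder map makes X_qn the tensor product of X_n and X_q. Hence an induced
-- cycle v in X_n, paired with any map c of the cycle into X_q sending neighbours to
-- neighbours, gives the induced cycle (v_i , c_i) in X_qn: adjacency there forces adjacency
-- of the v_i. For a prime q the graph X_q is complete, so c can be any proper colouring of
-- the cycle by residues below q; three colours always suffice and two for an even cycle.
-- For the monotonicity of m, take for q a prime factor of 2n + 1: it is odd and does not
-- divide n, so ω (q n) = ω n + 1.

module Submission where

open import Defs
open import Data.Nat
open import Data.Nat.Properties
open import Data.Nat.DivMod
open import Data.Nat.Divisibility
open import Data.Nat.Coprimality using (Coprime; coprime-divisor)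
  renaming (sym to coprime-sym)
open import Data.Nat.Primality
open import Data.Nat.Primality.Factorisation using (factorise)
open import Data.Nat.ListAction using (product)
open import Data.List.Relation.Unary.All using (_∷_)
open import Data.Fin using (Fin; toℕ; fromℕ<)
open import Data.Fin.Properties using (toℕ<n)
open import Data.List using ([]; _∷_; _++_; length; filter; upTo)
open import Data.List.Properties using (upTo-∷ʳ; length-++; filter-++; filter-accept; filter-reject)
open import Relation.Unary using (Pred; Decidable)
open import Relation.Nullary.Decidable using (_×-dec_)
open import Function.Base using (_∘_)
open import Data.Product.Function.NonDependent.Propositional using (_×-⇔_)
open import Data.Product using (_×_; ∃; _,_; proj₂)
open import Data.Sum using (_⊎_; inj₁; inj₂)
open import Function.Bundles using (_⇔_; mk⇔; Equivalence)
open import Relation.Nullary using (¬_; Dec; yes; no; contradiction)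
open import Relation.Binary.PropositionalEquality
open import Function.Properties.Equivalence using (⇔-setoid)
open import Level using (0ℓ)
import Relation.Binary.Reasoning.Setoid as SetoidReasoning

module ⇔-Reasoning = SetoidReasoning (⇔-setoid 0ℓ)

%-cong-+ : ∀ n .{{_ : NonZero n}} {x y s t} →
           x % n ≡ y % n → s % n ≡ t % n → (x + s) % n ≡ (y + t) % n
%-cong-+ n {x} {y} {s} {t} x≡y s≡t = begin
  (x + s) % n             ≡⟨ %-distribˡ-+ x s n ⟩
  (x % n + s % n) % n     ≡⟨ cong₂ (λ u v → (u + v) % n) x≡y s≡t ⟩
  (y % n + t % n) % n     ≡⟨ %-distribˡ-+ y t n ⟨
  (y + t) % n             ∎
  where open ≡-Reasoning

∣⇒[m+n]%d≡m%d : ∀ {d} .{{_ : NonZero d}} m {n} → d ∣ n → (m + n) % d ≡ m % d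
∣⇒[m+n]%d≡m%d {d} m (divides-refl k) = [m+kn]%n≡m%n m k d

∣⇒[m+n]%o%d≡m%d : ∀ {d o} .{{_ : NonZero d}} .{{_ : NonZero o}} m {n} → d ∣ o → d ∣ n →
                  (m + n) % o % d ≡ m % d
∣⇒[m+n]%o%d≡m%d {d} {o} m {n} d∣o d∣n =
  trans (m∣n⇒o%n%m≡o%m d o (m + n) d∣o) (∣⇒[m+n]%d≡m%d m d∣n)

-- Adding t = n ∸ c % n turns c into a multiple of n.
%-cancelʳ-+ : ∀ n .{{_ : NonZero n}} c {a b} → (a + c) % n ≡ (b + c) % n → a % n ≡ b % n
%-cancelʳ-+ n c {a} {b} e = begin
  a % n             ≡⟨ ∣⇒[m+n]%d≡m%d a n∣c+t ⟨
  (a + (c + t)) % n ≡⟨ cong (_% n) (+-assoc a c t) ⟨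
  (a + c + t) % n   ≡⟨ %-cong-+ n e refl ⟩
  (b + c + t) % n   ≡⟨ cong (_% n) (+-assoc b c t) ⟩
  (b + (c + t)) % n ≡⟨ ∣⇒[m+n]%d≡m%d b n∣c+t ⟩
  b % n             ∎
  where
  open ≡-Reasoning
  t = n ∸ c % n
  n∣c+t : n ∣ c + t
  n∣c+t = divides (suc (c / n)) (begin
    c + t                     ≡⟨ cong (_+ t) (m≡m%n+[m/n]*n c n) ⟩
    c % n + c / n * n + t     ≡⟨ +-assoc (c % n) _ t ⟩
    c % n + (c / n * n + t)   ≡⟨ cong (c % n +_) (+-comm (c / n * n) t) ⟩
    c % n + (t + c / n * n)   ≡⟨ +-assoc (c % n) t _ ⟨
    c % n + t + c / n * n     ≡⟨ cong (_+ c / n * n) (m+[n∸m]≡n (<⇒≤ (m%n<n c n))) ⟩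
    n + c / n * n             ∎)

%-cancelˡ-*-≤ : ∀ {n k a b} .{{_ : NonZero n}} → Coprime k n → a ≤ b → b < n →
                (k * a) % n ≡ (k * b) % n → a ≡ b
%-cancelˡ-*-≤ {n} {k} {a} k⊥n a≤b b<n e with m≤n⇒∃[o]m+o≡n a≤b
... | d , refl = sym (trans (cong (a +_) d≡0) (+-identityʳ a))
  where
  kd%n≡0 : (k * d) % n ≡ 0 % n
  kd%n≡0 = %-cancelʳ-+ n (k * a) (begin
    (k * d + k * a) % n ≡⟨ cong (_% n) (+-comm (k * d) (k * a)) ⟩
    (k * a + k * d) % n ≡⟨ cong (_% n) (*-distribˡ-+ k a d) ⟨
    (k * (a + d)) % n   ≡⟨ e ⟨
    (k * a) % n         ∎)
    where open ≡-Reasoning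
  n∣kd : n ∣ k * d
  n∣kd = m%n≡0⇒n∣m (k * d) n (trans kd%n≡0 (m*n%n≡0 0 n))
  d≡0 : d ≡ 0
  d≡0 = trans (sym (m<n⇒m%n≡m (≤-<-trans (m≤n+m d a) b<n)))
              (n∣m⇒m%n≡0 d n (coprime-divisor (coprime-sym k⊥n) n∣kd))

%-cancelˡ-*-< : ∀ {n k a b} .{{_ : NonZero n}} → Coprime k n → a < n → b < n →
                (k * a) % n ≡ (k * b) % n → a ≡ b
%-cancelˡ-*-< {a = a} {b} k⊥n a<n b<n e with ≤-total a b
... | inj₁ a≤b = %-cancelˡ-*-≤ k⊥n a≤b b<n e
... | inj₂ b≤a = sym (%-cancelˡ-*-≤ k⊥n b≤a a<n (sym e))

coprime-% : ∀ {n a b} .{{_ : NonZero n}} → a % n ≡ b % n → Coprime a n → Coprime b n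
coprime-% {n} e a⊥n (d∣b , d∣n) =
  a⊥n (∣n∣m%n⇒∣m d∣n (subst (_ ∣_) (sym e) (%-presˡ-∣ d∣b d∣n)) , d∣n)

coprime-%⇔ : ∀ {n a b} .{{_ : NonZero n}} → a % n ≡ b % n → Coprime a n ⇔ Coprime b n
coprime-%⇔ e = mk⇔ (coprime-% e) (coprime-% (sym e))

coprime-∣ˡ : ∀ {a b n} → a ∣ b → Coprime b n → Coprime a n
coprime-∣ˡ a∣b b⊥n (d∣a , d∣n) = b⊥n (∣-trans d∣a a∣b , d∣n)

coprime-∣ʳ : ∀ {a m n} → m ∣ n → Coprime a n → Coprime a m
coprime-∣ʳ m∣n a⊥n = coprime-sym (coprime-∣ˡ m∣n (coprime-sym a⊥n))

coprime-* : ∀ {a b n} → Coprime a n → Coprime b n → Coprime (a * b) n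
coprime-* {a} a⊥n b⊥n (d∣ab , d∣n) = b⊥n (coprime-divisor d⊥a d∣ab , d∣n)
  where
  d⊥a : Coprime _ a
  d⊥a (e∣d , e∣a) = a⊥n (e∣a , ∣-trans e∣d d∣n)

coprime-*ʳ⇔ : ∀ {a m n} → Coprime a (m * n) ⇔ (Coprime a m × Coprime a n)
coprime-*ʳ⇔ {a} {m} {n} = mk⇔ split (λ (a⊥m , a⊥n) → coprime-*ʳ a⊥m a⊥n)
  where
  split : Coprime a (m * n) → Coprime a m × Coprime a n
  split a⊥mn = coprime-∣ʳ (m∣m*n n) a⊥mn , coprime-∣ʳ (n∣m*n m) a⊥mn
  coprime-*ʳ : Coprime a m → Coprime a n → Coprime a (m * n)
  coprime-*ʳ a⊥m a⊥n = coprime-sym (coprime-* (coprime-sym a⊥m) (coprime-sym a⊥n))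

coprime-*ˡ⇔ : ∀ {k a n} → Coprime k n → Coprime (k * a) n ⇔ Coprime a n
coprime-*ˡ⇔ {k} k⊥n = mk⇔ (coprime-∣ˡ (n∣m*n k)) (coprime-* k⊥n)

prime∤⇒coprime : ∀ {p a} → Prime p → ¬ p ∣ a → Coprime a p
prime∤⇒coprime p-prime p∤a (d∣a , d∣p) with prime⇒irreducible p-prime d∣p
... | inj₁ d≡1 = d≡1
... | inj₂ refl = contradiction d∣a p∤a

-- For y ≤ n this represents x − y modulo n; subMod n x y is its remainder.
diff : ℕ → ℕ → ℕ → ℕ
diff n x y = x + (n ∸ y)

diff-+ : ∀ n x {y} → y ≤ n → diff n x y + y ≡ x + n
diff-+ n x {y} y≤n = trans (+-assoc x (n ∸ y) y) (cong (x +_) (m∸n+n≡m y≤n))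

adj⇔coprime-diff : ∀ {n x y} .{{_ : NonZero n}} → Adj n x y ⇔ Coprime (diff n x y) n
adj⇔coprime-diff {n@(suc _)} {x} {y} = mk⇔ (λ (_ , r⊥n) → from-% r⊥n) to-%
  where
  d = diff n x y
  from-% : Coprime (d % n) n → Coprime d n
  from-% = coprime-% (m%n%n≡m%n d n)
  to-% : Coprime d n → Adj n x y
  to-% d⊥n = m%n<n d n , coprime-% (sym (m%n%n≡m%n d n)) d⊥n

diff-%-* : ∀ {n N} .{{_ : NonZero n}} k {u u′ a a′} → n ∣ N → u′ ≤ N → a′ ≤ n →
           u % n ≡ (k * a) % n → u′ % n ≡ (k * a′) % n →
           diff N u u′ % n ≡ (k * diff n a a′) % n
diff-%-* {n} {N} k {u} {u′} {a} {a′} n∣N u′≤N a′≤n u≡ka u′≡ka′ =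
  %-cancelʳ-+ n (k * a′) (begin
    (diff N u u′ + k * a′) % n     ≡⟨ %-cong-+ n refl (sym u′≡ka′) ⟩
    (diff N u u′ + u′) % n         ≡⟨ cong (_% n) (diff-+ N u u′≤N) ⟩
    (u + N) % n                    ≡⟨ ∣⇒[m+n]%d≡m%d u n∣N ⟩
    u % n                          ≡⟨ u≡ka ⟩
    (k * a) % n                    ≡⟨ ∣⇒[m+n]%d≡m%d (k * a) (n∣m*n k) ⟨
    (k * a + k * n) % n            ≡⟨ cong (_% n) (*-distribˡ-+ k a n) ⟨
    (k * (a + n)) % n              ≡⟨ cong (λ z → (k * z) % n) (diff-+ n a a′≤n) ⟨
    (k * (diff n a a′ + a′)) % n   ≡⟨ cong (_% n) (*-distribˡ-+ k (diff n a a′) a′) ⟩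
    (k * diff n a a′ + k * a′) % n ∎)
  where open ≡-Reasoning

coprime-diff⇔adj : ∀ {n N k u u′ a a′} .{{_ : NonZero n}} →
                   Coprime k n → n ∣ N → u′ ≤ N → a′ ≤ n →
                   u % n ≡ (k * a) % n → u′ % n ≡ (k * a′) % n →
                   Coprime (diff N u u′) n ⇔ Adj n a a′
coprime-diff⇔adj {n} {N} {k} {u} {u′} {a} {a′} k⊥n n∣N u′≤N a′≤n u≡ka u′≡ka′ = begin
  Coprime (diff N u u′) n     ≈⟨ coprime-%⇔ (diff-%-* k n∣N u′≤N a′≤n u≡ka u′≡ka′) ⟩
  Coprime (k * diff n a a′) n ≈⟨ coprime-*ˡ⇔ k⊥n ⟩
  Coprime (diff n a a′) n     ≈⟨ adj⇔coprime-diff ⟨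
  Adj n a a′                  ∎
  where open ⇔-Reasoning

Neighbours : (k : ℕ) → Fin k → Fin k → Set
Neighbours k i j = toℕ j ≡ succMod k (toℕ i) ⊎ toℕ i ≡ succMod k (toℕ j)

inducedCycle⇒nonZero : ∀ {n k} → InducedCycle n k → NonZero n
inducedCycle⇒nonZero C = >-nonZero (≤-<-trans z≤n (v<n (fromℕ< (≤-trans (s≤s z≤n) three≤k))))
  where open InducedCycle C

module CRT {q n : ℕ} .{{_ : NonZero q}} .{{_ : NonZero n}} where

  instance
    q*n≢0 : NonZero (q * n)
    q*n≢0 = m*n≢0 q n

  crt : ℕ → ℕ → ℕ
  crt a b = (q * a + n * b) % (q * n)

  crt-< : ∀ a b → crt a b < q * n
  crt-< a b = m%n<n (q * a + n * b) (q * n)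

  crt-%ˡ : ∀ a b → crt a b % n ≡ (q * a) % n
  crt-%ˡ a b = ∣⇒[m+n]%o%d≡m%d (q * a) (n∣m*n q) (m∣m*n b)

  crt-%ʳ : ∀ a b → crt a b % q ≡ (n * b) % q
  crt-%ʳ a b = trans (cong (λ z → z % (q * n) % q) (+-comm (q * a) (n * b)))
                     (∣⇒[m+n]%o%d≡m%d (n * b) (m∣m*n n) (m∣m*n a))

  adj-crt⇔ : ∀ {a b a′ b′} → Coprime q n → a′ < n → b′ < q →
             Adj (q * n) (crt a b) (crt a′ b′) ⇔ (Adj q b b′ × Adj n a a′)
  adj-crt⇔ {a} {b} {a′} {b′} q⊥n a′<n b′<q = begin
    Adj (q * n) (crt a b) (crt a′ b′) ≈⟨ adj⇔coprime-diff ⟩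
    Coprime D (q * n)                 ≈⟨ coprime-*ʳ⇔ ⟩
    (Coprime D q × Coprime D n)       ≈⟨ mod-q ×-⇔ mod-n ⟩
    (Adj q b b′ × Adj n a a′)         ∎
    where
    open ⇔-Reasoning
    D = diff (q * n) (crt a b) (crt a′ b′)
    crt′≤qn = <⇒≤ (crt-< a′ b′)
    mod-q : Coprime D q ⇔ Adj q b b′
    mod-q = coprime-diff⇔adj (coprime-sym q⊥n) (m∣m*n n) crt′≤qn (<⇒≤ b′<q) (crt-%ʳ a b) (crt-%ʳ a′ b′)
    mod-n : Coprime D n ⇔ Adj n a a′
    mod-n = coprime-diff⇔adj q⊥n (n∣m*n q) crt′≤qn (<⇒≤ a′<n) (crt-%ˡ a b) (crt-%ˡ a′ b′)

  inducedCycle-crt : ∀ {k} → Coprime q n → (C : InducedCycle n k) →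
                     (c : Fin k → ℕ) → (∀ i → c i < q) →
                     (∀ i j → Neighbours k i j → Adj q (c i) (c j)) → InducedCycle (q * n) k
  inducedCycle-crt {k} q⊥n C c c<q c-hom = record
    { three≤k  = three≤k
    ; v        = w
    ; v<n      = λ i → crt-< (v i) (c i)
    ; distinct = λ {i} {j} → distinct ∘ w-injective i j
    ; adj→nbr  = λ i j wi~wj → adj→nbr i j (proj₂ (Equivalence.to (adj-crt⇔′ i j) wi~wj))
    ; nbr→adj  = λ i j i~j → Equivalence.from (adj-crt⇔′ i j) (c-hom i j i~j , nbr→adj i j i~j)
    }
    where
    open InducedCycle C
    w : Fin k → ℕ
    w i = crt (v i) (c i)
    adj-crt⇔′ : ∀ i j → Adj (q * n) (w i) (w j) ⇔ (Adj q (c i) (c j) × Adj n (v i) (v j))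
    adj-crt⇔′ i j = adj-crt⇔ q⊥n (v<n j) (c<q j)
    w-injective : ∀ i j → w i ≡ w j → v i ≡ v j
    w-injective i j wi≡wj = %-cancelˡ-*-< q⊥n (v<n i) (v<n j)
      (trans (sym (crt-%ˡ (v i) (c i))) (trans (cong (_% n) wi≡wj) (crt-%ˡ (v j) (c j))))

adj-prime : ∀ {p a b} → Prime p → a < p → b < p → a ≢ b → Adj p a b
adj-prime {p@(suc _)} {a} {b} p-prime a<p b<p a≢b =
  Equivalence.from (adj⇔coprime-diff {p} {a} {b}) (prime∤⇒coprime p-prime p∤diff)
  where
  p∤diff : ¬ p ∣ diff p a b
  p∤diff p∣diff = a≢b (begin
    a                     ≡⟨ m<n⇒m%n≡m a<p ⟨
    a % p                 ≡⟨ [m+n]%n≡m%n a p ⟨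
    (a + p) % p           ≡⟨ cong (_% p) (diff-+ p a (<⇒≤ b<p)) ⟨
    (diff p a b + b) % p  ≡⟨ %-cong-+ p {diff p a b} {0} {b} {b} (n∣m⇒m%n≡0 _ p p∣diff) refl ⟩
    b % p                 ≡⟨ m<n⇒m%n≡m b<p ⟩
    b                     ∎)
    where open ≡-Reasoning

inducedCycle-prime-* : ∀ {n k q} → Prime q → ¬ q ∣ n → (C : InducedCycle n k) →
                       (c : Fin k → ℕ) → (∀ i → c i < q) →
                       (∀ i j → Neighbours k i j → c i ≢ c j) → InducedCycle (q * n) k
inducedCycle-prime-* {n} {k} {q} q-prime q∤n C c c<q c-proper =
  CRT.inducedCycle-crt {q} {n} {{prime⇒nonZero q-prime}} {{inducedCycle⇒nonZero C}}
    (coprime-sym (prime∤⇒coprime q-prime q∤n)) C c c<q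
    (λ i j i~j → adj-prime q-prime (c<q i) (c<q j) (c-proper i j i~j))

alternating : ℕ → ℕ
alternating 0             = 0
alternating 1             = 1
alternating (suc (suc a)) = alternating a

alternating-< : ∀ a → alternating a < 2
alternating-< 0             = s≤s z≤n
alternating-< 1             = s≤s (s≤s z≤n)
alternating-< (suc (suc a)) = alternating-< a

alternating-suc : ∀ a → alternating a ≢ alternating (suc a)
alternating-suc 0             ()
alternating-suc 1             ()
alternating-suc (suc (suc a)) = alternating-suc a

alternating-even : ∀ x → alternating (x * 2) ≡ 0
alternating-even 0       = refl
alternating-even (suc x) = alternating-even x

-- The path 0, …, k − 2 alternates; vertex k − 1 gets a colour used by neither of its neighbours.
cycleColouring : ℕ → ℕ → ℕ
cycleColouring k a with suc a <? k
... | yes _ = alternating a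
... | no  _ = suc (alternating k)

cycleColouring-inner : ∀ {k a} → suc a < k → cycleColouring k a ≡ alternating a
cycleColouring-inner {k} {a} a+1<k with suc a <? k
... | yes _     = refl
... | no  a+1≮k = contradiction a+1<k a+1≮k

cycleColouring-last : ∀ {k a} → ¬ suc a < k → cycleColouring k a ≡ suc (alternating k)
cycleColouring-last {k} {a} a+1≮k with suc a <? k
... | yes a+1<k = contradiction a+1<k a+1≮k
... | no  _     = refl

cycleColouring-< : ∀ k a → cycleColouring k a < 3
cycleColouring-< k a with suc a <? k
... | yes _ = m<n⇒m<1+n (alternating-< a)
... | no  _ = s≤s (alternating-< k)

cycleColouring-<-even : ∀ {k} a → alternating k ≡ 0 → cycleColouring k a < 2
cycleColouring-<-even {k} a k-even with suc a <? k
... | yes _ = alternating-< a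
... | no  _ = s≤s (s≤s (≤-reflexive k-even))

cycleColouring-suc : ∀ {k a} → suc a < k → cycleColouring k a ≢ cycleColouring k (suc a)
cycleColouring-suc {k} {a} a+1<k rewrite cycleColouring-inner a+1<k = differs (suc (suc a) <? k)
  where
  differs : Dec (suc (suc a) < k) → alternating a ≢ cycleColouring k (suc a)
  differs (yes a+2<k) eq = alternating-suc a (trans eq (cycleColouring-inner a+2<k))
  differs (no  a+2≮k) eq = <⇒≢ (n<1+n (alternating a)) (begin
    alternating a                   ≡⟨ eq ⟩
    cycleColouring k (suc a)        ≡⟨ cycleColouring-last a+2≮k ⟩
    suc (alternating k)             ≡⟨ cong (suc ∘ alternating) (≤-antisym (≮⇒≥ a+2≮k) a+1<k) ⟩
    suc (alternating (suc (suc a))) ∎)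
    where open ≡-Reasoning

cycleColouring-succMod : ∀ {k a} → 3 ≤ k → a < k → cycleColouring k a ≢ cycleColouring k (succMod k a)
cycleColouring-succMod {k@(suc m)} {a} 3≤k a<k = differs (suc a <? k)
  where
  differs : Dec (suc a < k) → cycleColouring k a ≢ cycleColouring k (suc a % k)
  differs (yes a+1<k) rewrite m<n⇒m%n≡m a+1<k = cycleColouring-suc a+1<k
  differs (no  a+1≮k) eq = 1+n≢0 (begin
    suc (alternating k)          ≡⟨ cycleColouring-last a+1≮k ⟨
    cycleColouring k a           ≡⟨ eq ⟩
    cycleColouring k (suc a % k) ≡⟨ cong (λ z → cycleColouring k (z % k)) (≤-antisym a<k (≮⇒≥ a+1≮k)) ⟩
    cycleColouring k (k % k)     ≡⟨ cong (cycleColouring k) (n%n≡0 k) ⟩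
    cycleColouring k 0           ≡⟨ cycleColouring-inner (≤-trans (s≤s (s≤s z≤n)) 3≤k) ⟩
    0                            ∎)
    where open ≡-Reasoning

cycleColouring-proper : ∀ {k} → 3 ≤ k → ∀ i j → Neighbours k i j →
                        cycleColouring k (toℕ i) ≢ cycleColouring k (toℕ j)
cycleColouring-proper 3≤k i j (inj₁ j≡i⁺) rewrite j≡i⁺ = cycleColouring-succMod 3≤k (toℕ<n i)
cycleColouring-proper 3≤k i j (inj₂ i≡j⁺) rewrite i≡j⁺ = cycleColouring-succMod 3≤k (toℕ<n j) ∘ sym

module _ {P : Pred ℕ 0ℓ} (P? : Decidable P) where

  count : ℕ → ℕ
  count m = length (filter P? (upTo m))

  count-suc : ∀ m → count (suc m) ≡ count m + length (filter P? (m ∷ []))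
  count-suc m = begin
    length (filter P? (upTo (suc m)))                 ≡⟨ cong (length ∘ filter P?) (upTo-∷ʳ m) ⟨
    length (filter P? (upTo m ++ m ∷ []))             ≡⟨ cong length (filter-++ P? (upTo m) (m ∷ [])) ⟩
    length (filter P? (upTo m) ++ filter P? (m ∷ [])) ≡⟨ length-++ (filter P? (upTo m)) ⟩
    count m + length (filter P? (m ∷ []))             ∎
    where open ≡-Reasoning

  count-accept : ∀ {m} → P m → count (suc m) ≡ suc (count m)
  count-accept {m} Pm = trans (count-suc m)
    (trans (cong (λ l → count m + length l) (filter-accept P? Pm)) (+-comm (count m) 1))

  count-reject : ∀ {m} → ¬ P m → count (suc m) ≡ count m
  count-reject {m} ¬Pm = trans (count-suc m)
    (trans (cong (λ l → count m + length l) (filter-reject P? ¬Pm)) (+-identityʳ (count m)))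

  count-none : ∀ m → (∀ x → x < m → ¬ P x) → count m ≡ 0
  count-none zero    _    = refl
  count-none (suc m) none =
    trans (count-reject (none m ≤-refl)) (count-none m (λ x x<m → none x (m<n⇒m<1+n x<m)))

  count-stable : ∀ {m m′} → (∀ x → m ≤ x → ¬ P x) → m ≤ m′ → count m′ ≡ count m
  count-stable {m} {m′} none m≤m′ with m≤n⇒m<n∨m≡n m≤m′
  ... | inj₂ refl = refl
  ... | inj₁ (s≤s m≤m′-1) =
    trans (count-reject (none _ m≤m′-1)) (count-stable none m≤m′-1)

count-≡ : ∀ {q m} → q < m → count (_≟ q) m ≡ 1
count-≡ {q} {m} q<m = begin
  count (_≟ q) m       ≡⟨ count-stable (_≟ q) (λ x q<x → (<⇒≢ q<x) ∘ sym) q<m ⟩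
  count (_≟ q) (suc q) ≡⟨ count-accept (_≟ q) refl ⟩
  suc (count (_≟ q) q) ≡⟨ cong suc (count-none (_≟ q) q (λ x x<q → <⇒≢ x<q)) ⟩
  1                    ∎
  where open ≡-Reasoning

count-⊎ : ∀ {P Q R : Pred ℕ 0ℓ} (P? : Decidable P) (Q? : Decidable Q) (R? : Decidable R) →
          (∀ x → P x ⇔ (Q x ⊎ R x)) → (∀ x → Q x → ¬ R x) →
          ∀ m → count P? m ≡ count Q? m + count R? m
count-⊎ P? Q? R? P⇔Q⊎R Q⇒¬R zero = refl
count-⊎ {P} P? Q? R? P⇔Q⊎R Q⇒¬R (suc m) with Q? m | R? m
... | yes Qm | yes Rm = contradiction Rm (Q⇒¬R m Qm)
... | yes Qm | no ¬Rm = begin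
  count P? (suc m)                   ≡⟨ count-accept P? (Equivalence.from (P⇔Q⊎R m) (inj₁ Qm)) ⟩
  suc (count P? m)                   ≡⟨ cong suc (count-⊎ P? Q? R? P⇔Q⊎R Q⇒¬R m) ⟩
  suc (count Q? m + count R? m)      ≡⟨ cong₂ _+_ (count-accept Q? Qm) (count-reject R? ¬Rm) ⟨
  count Q? (suc m) + count R? (suc m) ∎
  where open ≡-Reasoning
... | no ¬Qm | yes Rm = begin
  count P? (suc m)                   ≡⟨ count-accept P? (Equivalence.from (P⇔Q⊎R m) (inj₂ Rm)) ⟩
  suc (count P? m)                   ≡⟨ cong suc (count-⊎ P? Q? R? P⇔Q⊎R Q⇒¬R m) ⟩
  suc (count Q? m + count R? m)      ≡⟨ +-suc (count Q? m) (count R? m) ⟨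
  count Q? m + suc (count R? m)      ≡⟨ cong₂ _+_ (count-reject Q? ¬Qm) (count-accept R? Rm) ⟨
  count Q? (suc m) + count R? (suc m) ∎
  where open ≡-Reasoning
... | no ¬Qm | no ¬Rm = begin
  count P? (suc m)                   ≡⟨ count-reject P? ¬Pm ⟩
  count P? m                         ≡⟨ count-⊎ P? Q? R? P⇔Q⊎R Q⇒¬R m ⟩
  count Q? m + count R? m            ≡⟨ cong₂ _+_ (count-reject Q? ¬Qm) (count-reject R? ¬Rm) ⟨
  count Q? (suc m) + count R? (suc m) ∎
  where
  open ≡-Reasoning
  ¬Pm : ¬ P m
  ¬Pm Pm with Equivalence.to (P⇔Q⊎R m) Pm
  ... | inj₁ Qm = ¬Qm Qm
  ... | inj₂ Rm = ¬Rm Rm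

primeDivisor? : ∀ n → Decidable (λ p → Prime p × p ∣ n)
primeDivisor? n p = prime? p ×-dec (p ∣? n)

ω-* : ∀ {q n} .{{_ : NonZero n}} → Prime q → ¬ q ∣ n → ω (q * n) ≡ suc (ω n)
ω-* {q} {n} q-prime q∤n = begin
  ω (q * n)                                  ≡⟨ count-⊎ (primeDivisor? (q * n)) (primeDivisor? n) (_≟ q)
                                                  divisor-split other-than-q N ⟩
  count (primeDivisor? n) N + count (_≟ q) N ≡⟨ cong₂ _+_ (count-stable (primeDivisor? n) beyond-n (s≤s n≤qn))
                                                          (count-≡ (s≤s q≤qn)) ⟩
  ω n + 1                                    ≡⟨ +-comm (ω n) 1 ⟩
  suc (ω n)                                  ∎
  where
  open ≡-Reasoning
  N = suc (q * n)
  n≤qn : n ≤ q * n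
  n≤qn = m≤n*m n q {{prime⇒nonZero q-prime}}
  q≤qn : q ≤ q * n
  q≤qn = m≤m*n q n
  other-than-q : ∀ x → Prime x × x ∣ n → x ≢ q
  other-than-q x (_ , x∣n) refl = q∤n x∣n
  beyond-n : ∀ x → suc n ≤ x → ¬ (Prime x × x ∣ n)
  beyond-n x n<x (_ , x∣n) = <⇒≱ n<x (∣⇒≤ x∣n)
  divisor-split : ∀ x → (Prime x × x ∣ q * n) ⇔ ((Prime x × x ∣ n) ⊎ x ≡ q)
  divisor-split x = mk⇔ to from
    where
    to : Prime x × x ∣ q * n → (Prime x × x ∣ n) ⊎ x ≡ q
    to (x-prime , x∣qn) with euclidsLemma q n x-prime x∣qn
    ... | inj₂ x∣n = inj₁ (x-prime , x∣n)
    ... | inj₁ x∣q with prime⇒irreducible q-prime x∣q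
    ...   | inj₁ refl = contradiction x-prime ¬prime[1]
    ...   | inj₂ x≡q = inj₂ x≡q
    from : (Prime x × x ∣ n) ⊎ x ≡ q → Prime x × x ∣ q * n
    from (inj₁ (x-prime , x∣n)) = x-prime , ∣-trans x∣n (n∣m*n q)
    from (inj₂ refl)            = q-prime , m∣m*n n

coprime-1+k*n : ∀ k n → Coprime (suc (k * n)) n
coprime-1+k*n k n {d} (d∣1+kn , d∣n) =
  ∣1⇒≡1 (∣m+n∣m⇒∣n (subst (d ∣_) (+-comm 1 (k * n)) d∣1+kn) (∣-trans d∣n (n∣m*n k)))

prime-factor : ∀ m → 1 < m → ∃ λ p → Prime p × p ∣ m
prime-factor m@(suc _) 1<m with factorise m
... | record { factors = [] ; isFactorisation = m≡1 } = contradiction (sym m≡1) (<⇒≢ 1<m)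
... | record { factors = p ∷ ps ; isFactorisation = m≡p*Πps ; factorsPrime = p-prime ∷ _ } =
  p , p-prime , subst (p ∣_) (sym m≡p*Πps) (m∣m*n (product ps))

∃oddPrime∤ : ∀ n → .{{_ : NonZero n}} → ∃ λ q → Prime q × 2 < q × ¬ q ∣ n
∃oddPrime∤ n with prime-factor (suc (2 * n)) (s≤s (≤-trans (>-nonZero⁻¹ n) (m≤n*m n 2)))
... | q , q-prime , q∣2n+1 = q , q-prime , 2<q , q∤n
  where
  q≢1 : q ≢ 1
  q≢1 = nonTrivial⇒≢1 {{prime⇒nonTrivial q-prime}}
  q∤n : ¬ q ∣ n
  q∤n q∣n = q≢1 (coprime-1+k*n 2 n (q∣2n+1 , q∣n))
  2<q : 2 < q
  2<q = ≤∧≢⇒< (nonTrivial⇒n>1 q {{prime⇒nonTrivial q-prime}}) λ where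
    refl → q≢1 (coprime-1+k*n n 2 (subst (λ m → 2 ∣ suc m) (*-comm 2 n) q∣2n+1 , ∣-refl))

inducedCycle-oddPrime-* : ∀ {n k q} → InducedCycle n k → Prime q → 2 < q → ¬ q ∣ n →
                          InducedCycle (q * n) k
inducedCycle-oddPrime-* {k = k} C q-prime 2<q q∤n =
  inducedCycle-prime-* q-prime q∤n C (cycleColouring k ∘ toℕ)
    (λ i → ≤-trans (cycleColouring-< k (toℕ i)) 2<q)
    (cycleColouring-proper (InducedCycle.three≤k C))

inducedCycle-2-* : ∀ {n k} → InducedCycle n k → 2 ∣ k → ¬ 2 ∣ n → InducedCycle (2 * n) k
inducedCycle-2-* {k = k} C (divides-refl x) 2∤n =
  inducedCycle-prime-* prime[2] 2∤n C (cycleColouring k ∘ toℕ)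
    (λ i → cycleColouring-<-even {k} (toℕ i) (alternating-even x))
    (cycleColouring-proper (InducedCycle.three≤k C))

inducedCycle-ω-suc : ∀ {n k} → InducedCycle n k → ∃ λ n′ → ω n′ ≡ suc (ω n) × InducedCycle n′ k
inducedCycle-ω-suc {n} C with ∃oddPrime∤ n {{inducedCycle⇒nonZero C}}
... | q , q-prime , 2<q , q∤n =
  q * n , ω-* {{inducedCycle⇒nonZero C}} q-prime q∤n , inducedCycle-oddPrime-* C q-prime 2<q q∤n

proposition2p8 : (∀ (n k q : ℕ) → 2 ≤ n → InducedCycle n k → Prime q → 2 < q → ¬ (q ∣ n) →
    InducedCycle (q * n) k)
    × (∀ (n k : ℕ) → 2 ≤ n → InducedCycle n k → 2 ∣ k → ¬ (2 ∣ n) →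
    InducedCycle (2 * n) k)
    × (∀ (r : ℕ) → 1 ≤ r → ∀ (n k : ℕ) → ω n ≡ r → InducedCycle n k →
    ∃ λ n′ → ∃ λ k′ → ω n′ ≡ suc r × InducedCycle n′ k′ × k ≤ k′)
proposition2p8 =
    (λ _ _ _ _ → inducedCycle-oddPrime-*)
  , (λ _ _ _ → inducedCycle-2-*)
  , λ where
      _ _ n k refl C → let (n′ , ω-n′ , C′) = inducedCycle-ω-suc C in n′ , k , ω-n′ , C′ , ≤-refl
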